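{- For every integer $r \geq 3$, there are infinitely many (pairwise non-isomorphic) connected $r$-regular permutation graphs.
   Context: All graphs are finite and simple. A graph $G$ on $n$ vertices is a permutation graph if there is a labeling $v_1, \ldots, v_n$ of its vertices and a permutation $\pi$ of $\{1,\ldots,n\}$ such that for $i<j$, the vertices $v_i$ and $v_j$ are adjacent if and only if $\pi(i) > \pi(j)$. -}

module Defs where

open import Data.Nat using (ℕ; zero; suc; _+_)
open import Data.Bool using (Bool; true; false; if_then_else_)
open import Data.Fin using (Fin; _<_)
open import Data.Fin.Permutation using (Permutation′; _⟨$⟩ʳ_)
open import Data.List using (map; allFin)
open import Data.Nat.ListAction using (sum)
open import Data.Product using (Σ; _×_; ∃)
open import Relation.Binary.PropositionalEquality using (_≡_)
open import Relation.Nullary using (¬_)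
open import Function.Bundles using (_⇔_)

record Graph (n : ℕ) : Set where
  field
    adj     : Fin n → Fin n → Bool
    symm    : ∀ u v → adj u v ≡ adj v u
    irrefl  : ∀ v → adj v v ≡ false
open Graph public

degree : ∀ {n} → Graph n → Fin n → ℕ
degree {n} G v = sum (map (λ u → if adj G v u then 1 else 0) (allFin n))

Regular : ∀ {n} → ℕ → Graph n → Set
Regular r G = ∀ v → degree G v ≡ r

data Reach {n : ℕ} (G : Graph n) : Fin n → Fin n → Set where
  here : ∀ {v} → Reach G v v
  step : ∀ {u w v} → adj G u w ≡ true → Reach G w v → Reach G u v

Connected : ∀ {n} → Graph n → Set
Connected G = ∀ u v → Reach G u v

-- G is a permutation graph: there is a labelling v_1..v_n of its vertices
-- (a bijection σ from positions to vertices) and a permutation π such that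
-- for i < j, v_i ~ v_j iff π(i) > π(j).
IsPermutationGraph : ∀ {n} → Graph n → Set
IsPermutationGraph {n} G =
  Σ (Permutation′ n) λ σ → Σ (Permutation′ n) λ π →
    ∀ (i j : Fin n) → i < j →
      (adj G (σ ⟨$⟩ʳ i) (σ ⟨$⟩ʳ j) ≡ true) ⇔ (π ⟨$⟩ʳ j < π ⟨$⟩ʳ i)

Isomorphic : ∀ {m n} → Graph m → Graph n → Set
Isomorphic {m} {n} G H =
  Σ (Data.Fin.Permutation.Permutation m n) λ f →
    ∀ u v → adj G u v ≡ adj H (f ⟨$⟩ʳ u) (f ⟨$⟩ʳ v)

AnyGraph : Set
AnyGraph = Σ ℕ Graph

-- Blow up the path on L = 4k + 6 blocks: consecutive blocks are completely joined, the two
-- end blocks become cliques and all other blocks independent sets. With the block sizes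
-- 2, r-1, r-2, 1 repeated, every vertex has exactly r neighbours, and the orders of these
-- connected graphs grow strictly with k. The blow-up is a permutation graph: put the blocks
-- in the order 1, 0, 3, 2, … on one line and 0, 2, 1, 4, 3, …, L-2, L-3, L-1 on the other,
-- listing the vertices of a block in reverse on the second line exactly when the block is a
-- clique; two vertices are then adjacent iff their order on the two lines differs.

module Submission where

open import Data.Bool using (Bool; true; false; if_then_else_; _∧_; _∨_; not)
open import Data.Bool.Properties using (∧-identityʳ; ∧-zeroʳ; ∨-identityʳ; ∨-comm; ∨-zeroʳ)
open import Data.Empty using (⊥-elim)
open import Data.Fin using (Fin; toℕ; fromℕ<)
open import Data.Fin.Properties using (toℕ-fromℕ<; toℕ-injective; toℕ<n)
open import Data.Fin.Permutation using (Permutation′; permutation; _⟨$⟩ʳ_; refute)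
open import Data.List using (map; allFin; tabulate)
open import Data.List.Properties using (map-tabulate)
open import Data.Nat
open import Data.Nat.ListAction using (sum)
open import Data.Nat.Properties
open import Data.Nat.Tactic.RingSolver using (solve-∀)
open import Algebra.Properties.CommutativeSemigroup +-commutativeSemigroup
  using (interchange; xy∙z≈xz∙y)
open import Data.Product using (Σ; ∃; _×_; _,_; proj₁; proj₂)
open import Data.Sum using (_⊎_; inj₁; inj₂)
open import Function.Bundles using (_⇔_; mk⇔)
open import Function.Properties.Equivalence using () renaming (trans to ⇔-trans)
open import Relation.Binary.Definitions using (tri<; tri≈; tri>)
open import Relation.Binary.PropositionalEquality
open import Relation.Nullary using (¬_; yes; no)
open import Relation.Nullary.Decidable using (dec-true; dec-false)

open import Defs

𝟙 : Bool → ℕ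
𝟙 b = if b then 1 else 0

≡ᵇ-refl : ∀ m → (m ≡ᵇ m) ≡ true
≡ᵇ-refl m = dec-true (m ≟ m) refl

≢⇒≡ᵇ-false : ∀ {m n} → m ≢ n → (m ≡ᵇ n) ≡ false
≢⇒≡ᵇ-false {m} {n} = dec-false (m ≟ n)

≡ᵇ-sym : ∀ m n → (m ≡ᵇ n) ≡ (n ≡ᵇ m)
≡ᵇ-sym zero    zero    = refl
≡ᵇ-sym zero    (suc n) = refl
≡ᵇ-sym (suc m) zero    = refl
≡ᵇ-sym (suc m) (suc n) = ≡ᵇ-sym m n

𝟙-∧-not : ∀ b c → 𝟙 (b ∧ not c) + 𝟙 b * 𝟙 c ≡ 𝟙 b
𝟙-∧-not true  true  = refl
𝟙-∧-not true  false = refl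
𝟙-∧-not false c     = refl

sum< : ℕ → (ℕ → ℕ) → ℕ
sum< zero    f = 0
sum< (suc n) f = f 0 + sum< n (λ x → f (suc x))

syntax sum< n (λ x → e) = ∑[ x < n ] e

sum<-cong : ∀ n {f g : ℕ → ℕ} → (∀ x → x < n → f x ≡ g x) → sum< n f ≡ sum< n g
sum<-cong zero    _   = refl
sum<-cong (suc n) f≗g = cong₂ _+_ (f≗g 0 z<s) (sum<-cong n (λ x x<n → f≗g (suc x) (s<s x<n)))

sum<-+ : ∀ m n (f : ℕ → ℕ) → sum< (m + n) f ≡ sum< m f + ∑[ x < n ] f (m + x)
sum<-+ zero    n f = refl
sum<-+ (suc m) n f = trans (cong (f 0 +_) (sum<-+ m n (λ x → f (suc x)))) (sym (+-assoc (f 0) _ _))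

sum<-suc : ∀ n (f : ℕ → ℕ) → sum< (suc n) f ≡ sum< n f + f n
sum<-suc zero    f = +-comm (f 0) 0
sum<-suc (suc n) f = trans (cong (f 0 +_) (sum<-suc n (λ x → f (suc x)))) (sym (+-assoc (f 0) _ _))

sum<-const : ∀ n c → ∑[ _ < n ] c ≡ n * c
sum<-const zero    c = refl
sum<-const (suc n) c = cong (c +_) (sum<-const n c)

sum<-zero : ∀ n → ∑[ _ < n ] 0 ≡ 0
sum<-zero n = trans (sum<-const n 0) (*-zeroʳ n)

sum<-distrib : ∀ n (f g : ℕ → ℕ) → ∑[ x < n ] (f x + g x) ≡ sum< n f + sum< n g
sum<-distrib zero    f g = refl
sum<-distrib (suc n) f g =
  trans (cong (f 0 + g 0 +_) (sum<-distrib n _ _)) (interchange (f 0) (g 0) _ _)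

sum<-indicator : ∀ n a (f : ℕ → ℕ) → a < n → ∑[ x < n ] (f x * 𝟙 (x ≡ᵇ a)) ≡ f a
sum<-indicator (suc n) zero    f _ = trans
  (cong₂ _+_ (*-identityʳ (f 0))
             (trans (sum<-cong n (λ x _ → *-zeroʳ (f (suc x)))) (sum<-zero n)))
  (+-identityʳ (f 0))
sum<-indicator (suc n) (suc a) f (s<s a<n) =
  trans (cong (_+ ∑[ x < n ] (f (suc x) * 𝟙 (x ≡ᵇ a))) (*-zeroʳ (f 0)))
        (sum<-indicator n a (λ x → f (suc x)) a<n)

sum<-indicator-≥ : ∀ n a (f : ℕ → ℕ) → n ≤ a → ∑[ x < n ] (f x * 𝟙 (x ≡ᵇ a)) ≡ 0
sum<-indicator-≥ zero    a       f _         = refl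
sum<-indicator-≥ (suc n) (suc a) f (s≤s n≤a) =
  trans (cong (_+ ∑[ x < n ] (f (suc x) * 𝟙 (x ≡ᵇ a))) (*-zeroʳ (f 0)))
        (sum<-indicator-≥ n a (λ x → f (suc x)) n≤a)

-- Blocks 0, 1, 2, … of the given sizes, laid out consecutively along ℕ; walk c t x is the
-- slot reached from slot t of block c after x steps.
module Layout (size : ℕ → ℕ) (size>0 : ∀ c → 0 < size c) where

  offset : ℕ → ℕ
  offset zero    = 0
  offset (suc c) = offset c + size c

  walk : ℕ → ℕ → ℕ → ℕ × ℕ
  walk c t zero    = c , t
  walk c t (suc x) with suc t <? size c
  ... | yes _ = walk c (suc t) x
  ... | no  _ = walk (suc c) 0 x

  block index : ℕ → ℕ
  block p = proj₁ (walk 0 0 p)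
  index p = proj₂ (walk 0 0 p)

  walk-inside : ∀ c t x → t + x < size c → walk c t x ≡ (c , t + x)
  walk-inside c t zero    _ = cong (c ,_) (sym (+-identityʳ t))
  walk-inside c t (suc x) t+x<s with suc t <? size c
  ... | yes _ = trans (walk-inside c (suc t) x (subst (_< size c) (+-suc t x) t+x<s))
                      (cong (c ,_) (sym (+-suc t x)))
  ... | no t+1≮s = ⊥-elim (t+1≮s (≤-<-trans (s≤s (m≤m+n t x)) (subst (_< size c) (+-suc t x) t+x<s)))

  walk-across : ∀ c t m x → t + suc m ≡ size c → walk c t (suc m + x) ≡ walk (suc c) 0 x
  walk-across c t m x t+m+1≡s with suc t <? size c | m
  ... | no _       | zero   = refl
  ... | yes t+1<s  | zero   = ⊥-elim (<-irrefl (trans (+-comm 1 t) t+m+1≡s) t+1<s)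
  ... | yes _      | suc m′ = walk-across c (suc t) m′ x (trans (sym (+-suc t (suc m′))) t+m+1≡s)
  ... | no t+1≮s   | suc m′ =
    ⊥-elim (t+1≮s (subst (suc t <_) (trans (sym (+-suc t (suc m′))) t+m+1≡s) (m<m+n (suc t) z<s)))

  walk-offset : ∀ c x → walk 0 0 (offset c + x) ≡ walk c 0 x
  walk-offset zero    x = refl
  walk-offset (suc c) x = begin
    walk 0 0 (offset c + size c + x)          ≡⟨ cong (walk 0 0) (+-assoc (offset c) (size c) x) ⟩
    walk 0 0 (offset c + (size c + x))        ≡⟨ walk-offset c (size c + x) ⟩
    walk c 0 (size c + x)                     ≡⟨ cong (λ s → walk c 0 (s + x)) s≡m+1 ⟩
    walk c 0 (suc m + x)                      ≡⟨ walk-across c 0 m x (sym s≡m+1) ⟩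
    walk (suc c) 0 x                          ∎
    where
    open ≡-Reasoning
    m = pred (size c)
    s≡m+1 : size c ≡ suc m
    s≡m+1 = sym (suc-pred (size c) {{>-nonZero (size>0 c)}})

  walk-slot : ∀ c t → t < size c → walk 0 0 (offset c + t) ≡ (c , t)
  walk-slot c t t<s = trans (walk-offset c t) (walk-inside c 0 t t<s)

  block-slot : ∀ c t → t < size c → block (offset c + t) ≡ c
  block-slot c t t<s = cong proj₁ (walk-slot c t t<s)

  index-slot : ∀ c t → t < size c → index (offset c + t) ≡ t
  index-slot c t t<s = cong proj₂ (walk-slot c t t<s)

  private
    +-suc-shift : ∀ {a} b {d} → a + suc b + d ≡ a + b + suc d
    +-suc-shift {a} b {d} = trans (cong (_+ d) (+-suc a b)) (sym (+-suc (a + b) d))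

  walk-invariant : ∀ c t x → t < size c →
    let (c′ , t′) = walk c t x in offset c′ + t′ ≡ offset c + t + x × t′ < size c′
  walk-invariant c t zero    t<s = sym (+-identityʳ _) , t<s
  walk-invariant c t (suc x) t<s with suc t <? size c
  ... | yes t+1<s = let (eq , bound) = walk-invariant c (suc t) x t+1<s
                    in trans eq (+-suc-shift t) , bound
  ... | no t+1≮s  = let (eq , bound) = walk-invariant (suc c) 0 x (size>0 (suc c))
                    in trans eq (trans (cong (_+ x) next-block) (+-suc-shift t)) , bound
    where
    next-block : offset c + size c + 0 ≡ offset c + suc t
    next-block = trans (+-identityʳ _) (cong (offset c +_) (≤-antisym (≮⇒≥ t+1≮s) t<s))

  offset-block-index : ∀ p → offset (block p) + index p ≡ p
  offset-block-index p = proj₁ (walk-invariant 0 0 p (size>0 0))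

  index<size : ∀ p → index p < size (block p)
  index<size p = proj₂ (walk-invariant 0 0 p (size>0 0))

  offset-mono-≤ : ∀ {a b} → a ≤ b → offset a ≤ offset b
  offset-mono-≤ {a} {b} a≤b with m≤n⇒∃[o]m+o≡n a≤b
  ... | d , refl = go a d
    where
    go : ∀ a d → offset a ≤ offset (a + d)
    go a zero    = ≤-reflexive (cong offset (sym (+-identityʳ a)))
    go a (suc d) = ≤-trans (go a d) (subst (offset (a + d) ≤_) (cong offset (sym (+-suc a d)))
                                           (m≤m+n (offset (a + d)) (size (a + d))))

  slot<offset : ∀ {a b t} → a < b → t < size a → offset a + t < offset b
  slot<offset {a} a<b t<s = <-≤-trans (+-monoʳ-< (offset a) t<s) (offset-mono-≤ a<b)

  offset-mono-< : ∀ {a b} → a < b → offset a < offset b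
  offset-mono-< {a} a<b = subst (_< _) (+-identityʳ (offset a)) (slot<offset a<b (size>0 a))

  slot<slot : ∀ {a b t t′} → a < b → t < size a → offset a + t < offset b + t′
  slot<slot {b = b} {t′ = t′} a<b t<s = <-≤-trans (slot<offset a<b t<s) (m≤m+n (offset b) t′)

  slot<slot-inv : ∀ {a b t t′} → t < size a → t′ < size b → offset a + t < offset b + t′ →
                  a < b ⊎ (a ≡ b × t < t′)
  slot<slot-inv {a} {b} t<s t′<s lt with <-cmp a b
  ... | tri< a<b _ _    = inj₁ a<b
  ... | tri≈ _ refl _   = inj₂ (refl , +-cancelˡ-< (offset a) _ _ lt)
  ... | tri> _ _ b<a    = ⊥-elim (<-asym lt (slot<slot b<a t′<s))

  block< : ∀ L p → p < offset L → block p < L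
  block< L p p<n with block p <? L
  ... | yes b<L = b<L
  ... | no  b≮L = ⊥-elim (<⇒≱ p<n (begin
    offset L                       ≤⟨ offset-mono-≤ (≮⇒≥ b≮L) ⟩
    offset (block p)               ≤⟨ m≤m+n _ (index p) ⟩
    offset (block p) + index p     ≡⟨ offset-block-index p ⟩
    p                              ∎))
    where open ≤-Reasoning

  sum<-blocks : ∀ L (g : ℕ → ℕ) → ∑[ p < offset L ] g (block p) ≡ ∑[ c < L ] (size c * g c)
  sum<-blocks zero    g = refl
  sum<-blocks (suc L) g = begin
    ∑[ p < offset L + size L ] g (block p)
      ≡⟨ sum<-+ (offset L) (size L) _ ⟩
    ∑[ p < offset L ] g (block p) + ∑[ t < size L ] g (block (offset L + t))
      ≡⟨ cong₂ _+_ (sum<-blocks L g) (sum<-cong (size L) (λ t t<s → cong g (block-slot L t t<s))) ⟩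
    ∑[ c < L ] (size c * g c) + ∑[ _ < size L ] g L
      ≡⟨ cong (∑[ c < L ] (size c * g c) +_) (sum<-const (size L) (g L)) ⟩
    ∑[ c < L ] (size c * g c) + size L * g L
      ≡⟨ sym (sum<-suc L (λ c → size c * g c)) ⟩
    ∑[ c < suc L ] (size c * g c)
      ∎
    where open ≡-Reasoning

record Bijection< (n : ℕ) : Set where
  field
    to from : ℕ → ℕ
    to<     : ∀ {x} → x < n → to x < n
    from<   : ∀ {y} → y < n → from y < n
    from-to : ∀ {x} → x < n → from (to x) ≡ x
    to-from : ∀ {y} → y < n → to (from y) ≡ y

module _ {n : ℕ} where
  open Bijection<

  infix  10 _⁻¹
  infixr 9  _∘<_

  _⁻¹ : Bijection< n → Bijection< n
  f ⁻¹ = record { to = from f ; from = to f ; to< = from< f ; from< = to< f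
                ; from-to = to-from f ; to-from = from-to f }

  _∘<_ : Bijection< n → Bijection< n → Bijection< n
  g ∘< f = record
    { to      = λ x → to g (to f x)
    ; from    = λ y → from f (from g y)
    ; to<     = λ x<n → to< g (to< f x<n)
    ; from<   = λ y<n → from< f (from< g y<n)
    ; from-to = λ x<n → trans (cong (from f) (from-to g (to< f x<n))) (from-to f x<n)
    ; to-from = λ y<n → trans (cong (to g) (to-from f (from< g y<n))) (to-from g y<n)
    }

-- Block c of the old layout becomes block π c of the new one, its slot t becoming slot ρ c t.
module Relayout
  (size : ℕ → ℕ) (size>0 : ∀ c → 0 < size c) (L : ℕ)
  (π : ℕ → ℕ) (π< : ∀ {c} → c < L → π c < L) (π-involutive : ∀ {c} → c < L → π (π c) ≡ c)
  (ρ : ℕ → ℕ → ℕ) (ρ< : ∀ c {t} → t < size c → ρ c t < size c)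
  (ρ-involutive : ∀ c {t} → t < size c → ρ c (ρ c t) ≡ t)
  where

  module Old = Layout size size>0
  module New = Layout (λ c → size (π c)) (λ c → size>0 (π c))

  moved : ℕ → ℕ
  moved v = New.offset (π (Old.block v)) + ρ (Old.block v) (Old.index v)

  restored : ℕ → ℕ
  restored p = Old.offset (π (New.block p)) + ρ (π (New.block p)) (New.index p)

  private
    ρ<size∘π∘π : ∀ {c t} → c < L → t < size c → ρ c t < size (π (π c))
    ρ<size∘π∘π {c} c<L t<s = subst (λ d → ρ c _ < size d) (sym (π-involutive c<L)) (ρ< c t<s)

    old-block< : ∀ {v} → v < Old.offset L → Old.block v < L
    old-block< {v} = Old.block< L v

  moved< : ∀ {v} → v < Old.offset L → moved v < New.offset L
  moved< {v} v<n = New.slot<offset (π< (old-block< v<n)) (ρ<size∘π∘π (old-block< v<n) (Old.index<size v))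

  restored< : ∀ {p} → p < New.offset L → restored p < Old.offset L
  restored< {p} p<n = Old.slot<offset (π< (New.block< L p p<n)) (ρ< _ (New.index<size p))

  restored-moved : ∀ {v} → v < Old.offset L → restored (moved v) ≡ v
  restored-moved {v} v<n = begin
    restored (moved v)
      ≡⟨ cong₂ (λ d t → Old.offset (π d) + ρ (π d) t)
               (New.block-slot (π c) (ρ c t) ρt<) (New.index-slot (π c) (ρ c t) ρt<) ⟩
    Old.offset (π (π c)) + ρ (π (π c)) (ρ c t)
      ≡⟨ cong (λ d → Old.offset d + ρ d (ρ c t)) (π-involutive c<L) ⟩
    Old.offset c + ρ c (ρ c t)
      ≡⟨ cong (Old.offset c +_) (ρ-involutive c (Old.index<size v)) ⟩
    Old.offset c + t
      ≡⟨ Old.offset-block-index v ⟩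
    v ∎
    where
    open ≡-Reasoning
    c = Old.block v
    t = Old.index v
    c<L = old-block< v<n
    ρt< = ρ<size∘π∘π c<L (Old.index<size v)

  moved-restored : ∀ {p} → p < New.offset L → moved (restored p) ≡ p
  moved-restored {p} p<n = begin
    moved (restored p)
      ≡⟨ cong₂ (λ c t → New.offset (π c) + ρ c t)
               (Old.block-slot (π d) (ρ (π d) t) ρt<) (Old.index-slot (π d) (ρ (π d) t) ρt<) ⟩
    New.offset (π (π d)) + ρ (π d) (ρ (π d) t)
      ≡⟨ cong₂ (λ e s → New.offset e + s) (π-involutive d<L) (ρ-involutive (π d) (New.index<size p)) ⟩
    New.offset d + t
      ≡⟨ New.offset-block-index p ⟩
    p ∎
    where
    open ≡-Reasoning
    d = New.block p
    t = New.index p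
    d<L = New.block< L p p<n
    ρt< = ρ< (π d) (New.index<size p)

  relayout : New.offset L ≡ Old.offset L → Bijection< (Old.offset L)
  relayout same-total = record
    { to      = moved
    ; from    = restored
    ; to<     = λ {v} v<n → subst (moved v <_) same-total (moved< v<n)
    ; from<   = λ {p} p<n → restored< (subst (p <_) (sym same-total) p<n)
    ; from-to = restored-moved
    ; to-from = λ {p} p<n → moved-restored (subst (p <_) (sym same-total) p<n)
    }

sum-map-allFin : ∀ n (f : ℕ → ℕ) → sum (map (λ i → f (toℕ i)) (allFin n)) ≡ sum< n f
sum-map-allFin n f = trans (cong sum (map-tabulate {n = n} (λ i → i) (λ i → f (toℕ i)))) (go n f)
  where
  go : ∀ n (f : ℕ → ℕ) → sum (tabulate {n = n} (λ i → f (toℕ i))) ≡ sum< n f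
  go zero    f = refl
  go (suc n) f = cong (f 0 +_) (go n (λ x → f (suc x)))

module _ {n : ℕ} where
  open Bijection<

  private
    restrict : (g : ℕ → ℕ) → (∀ {x} → x < n → g x < n) → Fin n → Fin n
    restrict g g< i = fromℕ< (g< (toℕ<n i))

    toℕ-restrict : ∀ g (g< : ∀ {x} → x < n → g x < n) i → toℕ (restrict g g< i) ≡ g (toℕ i)
    toℕ-restrict g g< i = toℕ-fromℕ< (g< (toℕ<n i))

    restrict-inverse : ∀ (f : Bijection< n) i →
                       restrict (to f) (to< f) (restrict (from f) (from< f) i) ≡ i
    restrict-inverse f i = toℕ-injective (begin
      toℕ (restrict (to f) (to< f) (restrict (from f) (from< f) i))
        ≡⟨ toℕ-restrict (to f) (to< f) _ ⟩
      to f (toℕ (restrict (from f) (from< f) i))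
        ≡⟨ cong (to f) (toℕ-restrict (from f) (from< f) i) ⟩
      to f (from f (toℕ i))
        ≡⟨ to-from f (toℕ<n i) ⟩
      toℕ i
        ∎)
      where open ≡-Reasoning

  toPermutation : Bijection< n → Permutation′ n
  toPermutation f = permutation (restrict (to f) (to< f)) (restrict (from f) (from< f))
                                (restrict-inverse f) (restrict-inverse (f ⁻¹))

  toℕ-toPermutation : ∀ f i → toℕ (toPermutation f ⟨$⟩ʳ i) ≡ to f (toℕ i)
  toℕ-toPermutation f i = toℕ-restrict (to f) (to< f) i

graphℕ : (n : ℕ) (A : ℕ → ℕ → Bool) →
         (∀ u v → A u v ≡ A v u) → (∀ v → A v v ≡ false) → Graph n
graphℕ n A A-sym A-irrefl = record
  { adj    = λ u v → A (toℕ u) (toℕ v)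
  ; symm   = λ u v → A-sym (toℕ u) (toℕ v)
  ; irrefl = λ v → A-irrefl (toℕ v)
  }

graphℕ-isPermutationGraph :
  ∀ {n} A A-sym A-irrefl (pos val : Bijection< n) →
  (∀ {u v} → u < n → v < n → Bijection<.to pos u < Bijection<.to pos v →
             A u v ≡ true ⇔ Bijection<.to val v < Bijection<.to val u) →
  IsPermutationGraph (graphℕ n A A-sym A-irrefl)
graphℕ-isPermutationGraph {n} A _ _ pos val inversions =
  toPermutation σ , toPermutation π , adjacent⇔inverted
  where
  open Bijection<
  σ π : Bijection< n
  σ = pos ⁻¹
  π = val ∘< pos ⁻¹

  adjacent⇔inverted : ∀ i j → toℕ i < toℕ j →
    A (toℕ (toPermutation σ ⟨$⟩ʳ i)) (toℕ (toPermutation σ ⟨$⟩ʳ j)) ≡ true ⇔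
    toℕ (toPermutation π ⟨$⟩ʳ j) < toℕ (toPermutation π ⟨$⟩ʳ i)
  adjacent⇔inverted i j i<j
    rewrite toℕ-toPermutation σ i | toℕ-toPermutation σ j
          | toℕ-toPermutation π i | toℕ-toPermutation π j =
    inversions (from< pos (toℕ<n i)) (from< pos (toℕ<n j))
      (subst₂ _<_ (sym (to-from pos (toℕ<n i))) (sym (to-from pos (toℕ<n j))) i<j)

module _ {n} {G : Graph n} where

  Reach-trans : ∀ {u v w} → Reach G u v → Reach G v w → Reach G u w
  Reach-trans here         q = q
  Reach-trans (step uv p)  q = step uv (Reach-trans p q)

  Reach-sym : ∀ {u v} → Reach G u v → Reach G v u
  Reach-sym here                    = here
  Reach-sym (step {u} {w} uw p) = Reach-trans (Reach-sym p) (step (trans (symm G w u) uw) here)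

reverseIf : Bool → ℕ → ℕ → ℕ
reverseIf true  s t = s ∸ suc t
reverseIf false s t = t

reverseIf-< : ∀ b {s t} → t < s → reverseIf b s t < s
reverseIf-< true  {suc s} {t} _  = s≤s (m∸n≤m s t)
reverseIf-< false             t<s = t<s

reverseIf-involutive : ∀ b {s t} → t < s → reverseIf b s (reverseIf b s t) ≡ t
reverseIf-involutive true  {suc s} (s≤s t≤s) = m∸[m∸n]≡n t≤s
reverseIf-involutive false         _         = refl

reverseIf-inverts : ∀ b {s t t′} → t < t′ → t′ < s → b ≡ true ⇔ reverseIf b s t′ < reverseIf b s t
reverseIf-inverts true  {suc s} t<t′ (s≤s t′≤s) = mk⇔ (λ _ → ∸-monoʳ-< t<t′ t′≤s) (λ _ → refl)
reverseIf-inverts false         t<t′ _           = mk⇔ (λ ()) (λ t′<t → ⊥-elim (<-asym t<t′ t′<t))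

module BlowUp (size : ℕ → ℕ) (size>0 : ∀ c → 0 < size c) (L : ℕ)
  (R : ℕ → ℕ → Bool) (R-sym : ∀ c d → R c d ≡ R d c) where

  open Layout size size>0

  order : ℕ
  order = offset L

  adjacentℕ : ℕ → ℕ → Bool
  adjacentℕ u v = R (block u) (block v) ∧ not (v ≡ᵇ u)

  adjacentℕ-sym : ∀ u v → adjacentℕ u v ≡ adjacentℕ v u
  adjacentℕ-sym u v = cong₂ (λ r e → r ∧ not e) (R-sym (block u) (block v)) (≡ᵇ-sym v u)

  adjacentℕ-irrefl : ∀ v → adjacentℕ v v ≡ false
  adjacentℕ-irrefl v = trans (cong (λ e → R (block v) (block v) ∧ not e) (≡ᵇ-refl v)) (∧-zeroʳ _)

  blowUp : Graph order
  blowUp = graphℕ order adjacentℕ adjacentℕ-sym adjacentℕ-irrefl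

  degreeℕ-blowUp : ∀ u → u < order →
    ∑[ x < order ] 𝟙 (adjacentℕ u x) + 𝟙 (R (block u) (block u)) ≡
    ∑[ c < L ] (size c * 𝟙 (R (block u) c))
  degreeℕ-blowUp u u<n = begin
    ∑[ x < order ] 𝟙 (Ru x ∧ not (x ≡ᵇ u)) + 𝟙 (Ru u)
      ≡⟨ cong (∑[ x < order ] 𝟙 (Ru x ∧ not (x ≡ᵇ u)) +_)
              (sym (sum<-indicator order u (λ x → 𝟙 (Ru x)) u<n)) ⟩
    ∑[ x < order ] 𝟙 (Ru x ∧ not (x ≡ᵇ u)) + ∑[ x < order ] (𝟙 (Ru x) * 𝟙 (x ≡ᵇ u))
      ≡⟨ sym (sum<-distrib order _ _) ⟩
    ∑[ x < order ] (𝟙 (Ru x ∧ not (x ≡ᵇ u)) + 𝟙 (Ru x) * 𝟙 (x ≡ᵇ u))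
      ≡⟨ sum<-cong order (λ x _ → 𝟙-∧-not (Ru x) (x ≡ᵇ u)) ⟩
    ∑[ x < order ] 𝟙 (Ru x)
      ≡⟨ sum<-blocks L (λ c → 𝟙 (R (block u) c)) ⟩
    ∑[ c < L ] (size c * 𝟙 (R (block u) c))
      ∎
    where
    open ≡-Reasoning
    Ru : ℕ → Bool
    Ru x = R (block u) (block x)

  blowUp-regular : ∀ r → (∀ a → a < L → ∑[ c < L ] (size c * 𝟙 (R a c)) ≡ r + 𝟙 (R a a)) →
                   Regular r blowUp
  blowUp-regular r block-degree v = +-cancelʳ-≡ _ _ _ (begin
    degree blowUp v + 𝟙 (R b b)
      ≡⟨ cong (_+ 𝟙 (R b b)) (sum-map-allFin order (λ x → 𝟙 (adjacentℕ (toℕ v) x))) ⟩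
    ∑[ x < order ] 𝟙 (adjacentℕ (toℕ v) x) + 𝟙 (R b b)
      ≡⟨ degreeℕ-blowUp (toℕ v) (toℕ<n v) ⟩
    ∑[ c < L ] (size c * 𝟙 (R b c))
      ≡⟨ block-degree b (block< L (toℕ v) (toℕ<n v)) ⟩
    r + 𝟙 (R b b)
      ∎)
    where
    open ≡-Reasoning
    b = block (toℕ v)

  adjacentℕ-≢ : ∀ {u v} → v ≢ u → adjacentℕ u v ≡ R (block u) (block v)
  adjacentℕ-≢ {u} {v} v≢u =
    trans (cong (λ e → R (block u) (block v) ∧ not e) (≢⇒≡ᵇ-false v≢u)) (∧-identityʳ _)

  blowUp-connected : 0 < L → R 0 0 ≡ true → (∀ c → suc c < L → R (suc c) c ≡ true) →
                     Connected blowUp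
  blowUp-connected 0<L R00 R-path u v = Reach-trans (reach-first u) (Reach-sym (reach-first v))
    where
    first-of : ∀ {c} → c < L → Fin order
    first-of {c} c<L = fromℕ< (slot<offset c<L (size>0 c))

    block-first-of : ∀ {c} (c<L : c < L) → block (toℕ (first-of c<L)) ≡ c
    block-first-of {c} c<L =
      trans (cong block (toℕ-fromℕ< (slot<offset c<L (size>0 c)))) (block-slot c 0 (size>0 c))

    reach : ∀ c (v : Fin order) → block (toℕ v) ≡ c → Reach blowUp v (first-of 0<L)
    reach zero v v∈0 with toℕ (first-of 0<L) ≟ toℕ v
    ... | yes first≡v = subst (λ w → Reach blowUp w _) (toℕ-injective first≡v) here
    ... | no  first≢v =
      step (trans (adjacentℕ-≢ first≢v) (trans (cong₂ R v∈0 (block-first-of 0<L)) R00)) here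
    reach (suc c) v v∈c+1 =
      step (trans (adjacentℕ-≢ w≢v) (trans (cong₂ R v∈c+1 (block-first-of c<L)) (R-path c c+1<L)))
           (reach c w (block-first-of c<L))
      where
      c+1<L : suc c < L
      c+1<L = subst (_< L) v∈c+1 (block< L (toℕ v) (toℕ<n v))
      c<L : c < L
      c<L = <-trans (n<1+n c) c+1<L
      w = first-of c<L
      w≢v : toℕ w ≢ toℕ v
      w≢v w≡v = 1+n≢n (trans (sym v∈c+1) (trans (cong block (sym w≡v)) (block-first-of c<L)))

    reach-first : ∀ v → Reach blowUp v (first-of 0<L)
    reach-first v = reach _ v refl

  module _
    (P Q : ℕ → ℕ)
    (P< : ∀ {c} → c < L → P c < L) (P-involutive : ∀ {c} → c < L → P (P c) ≡ c)
    (Q< : ∀ {c} → c < L → Q c < L) (Q-involutive : ∀ {c} → c < L → Q (Q c) ≡ c)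
    (P-total : Layout.offset (λ c → size (P c)) (λ c → size>0 (P c)) L ≡ order)
    (Q-total : Layout.offset (λ c → size (Q c)) (λ c → size>0 (Q c)) L ≡ order)
    (R-inversions : ∀ {c d} → c < L → d < L → c ≢ d → P c < P d → R c d ≡ true ⇔ Q d < Q c)
    where

    module Pos = Relayout size size>0 L P P< P-involutive (λ _ t → t) (λ _ t<s → t<s) (λ _ _ → refl)
    module Val = Relayout size size>0 L Q Q< Q-involutive
                   (λ c → reverseIf (R c c) (size c)) (λ c → reverseIf-< (R c c))
                   (λ c → reverseIf-involutive (R c c))

    private
      <size-involution : (π : ℕ → ℕ) → (∀ {c} → c < L → π (π c) ≡ c) →
                         ∀ {c x} → c < L → x < size c → x < size (π (π c))
      <size-involution π π-involutive {c} {x} c<L x<s = subst (λ d → x < size d) (sym (π-involutive c<L)) x<s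

      val-index< : ∀ {w} → w < order →
                   reverseIf (R (block w) (block w)) (size (block w)) (index w) < size (Q (Q (block w)))
      val-index< {w} w<n = <size-involution Q Q-involutive (block< L w w<n)
                                            (reverseIf-< (R (block w) (block w)) (index<size w))

    inversions-between-blocks : ∀ {u v} → u < order → v < order → P (block u) < P (block v) →
                                adjacentℕ u v ≡ true ⇔ Val.moved v < Val.moved u
    inversions-between-blocks {u} {v} u<n v<n Pc<Pd =
      subst (λ b → b ≡ true ⇔ Val.moved v < Val.moved u) (sym (adjacentℕ-≢ v≢u))
        (⇔-trans (R-inversions c<L d<L c≢d Pc<Pd)
                 (mk⇔ (λ Qd<Qc → Val.New.slot<slot Qd<Qc (val-index< v<n)) Qd<Qc))
      where
      c = block u
      d = block v
      c<L = block< L u u<n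
      d<L = block< L v v<n
      c≢d : c ≢ d
      c≢d c≡d = <-irrefl (cong P c≡d) Pc<Pd
      v≢u : v ≢ u
      v≢u v≡u = c≢d (cong block (sym v≡u))
      Qd<Qc : Val.moved v < Val.moved u → Q d < Q c
      Qd<Qc lt with Val.New.slot<slot-inv (val-index< v<n) (val-index< u<n) lt
      ... | inj₁ Qd<Qc        = Qd<Qc
      ... | inj₂ (Qd≡Qc , _) =
        ⊥-elim (c≢d (trans (sym (Q-involutive c<L)) (trans (cong Q (sym Qd≡Qc)) (Q-involutive d<L))))

    inversions-within-block : ∀ {u v} → v < order → block u ≡ block v → index u < index v →
                              adjacentℕ u v ≡ true ⇔ Val.moved v < Val.moved u
    inversions-within-block {u} {v} v<n c≡d t<t′ =
      subst (λ b → b ≡ true ⇔ Val.moved v < Val.moved u) (sym (adjacentℕ-≢ v≢u)) same-block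
      where
      v≢u : v ≢ u
      v≢u v≡u = <-irrefl (cong index (sym v≡u)) t<t′
      t′<s : index v < size (block u)
      t′<s = subst (λ c → index v < size c) (sym c≡d) (index<size v)
      same-block : R (block u) (block v) ≡ true ⇔ Val.moved v < Val.moved u
      same-block rewrite sym c≡d =
        ⇔-trans (reverseIf-inverts (R (block u) (block u)) t<t′ t′<s)
                (mk⇔ (+-monoʳ-< offset-c) (+-cancelˡ-< offset-c _ _))
        where offset-c = Val.New.offset (Q (block u))

    blowUp-inversions : ∀ {u v} → u < order → v < order → Pos.moved u < Pos.moved v →
                        adjacentℕ u v ≡ true ⇔ Val.moved v < Val.moved u
    blowUp-inversions {u} {v} u<n v<n pos-u<pos-v
      with Pos.New.slot<slot-inv (pos-index< u<n) (pos-index< v<n) pos-u<pos-v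
      where
      pos-index< : ∀ {w} → w < order → index w < size (P (P (block w)))
      pos-index< {w} w<n = <size-involution P P-involutive (block< L w w<n) (index<size w)
    ... | inj₁ Pc<Pd          = inversions-between-blocks u<n v<n Pc<Pd
    ... | inj₂ (Pc≡Pd , t<t′) = inversions-within-block v<n c≡d t<t′
      where
      c≡d : block u ≡ block v
      c≡d = trans (sym (P-involutive (block< L u u<n))) (trans (cong P Pc≡Pd) (P-involutive (block< L v v<n)))

    blowUp-isPermutationGraph : IsPermutationGraph blowUp
    blowUp-isPermutationGraph =
      graphℕ-isPermutationGraph adjacentℕ adjacentℕ-sym adjacentℕ-irrefl
        (Pos.relayout P-total) (Val.relayout Q-total) blowUp-inversions

twice : ℕ → ℕ
twice zero    = zero
twice (suc m) = suc (suc (twice m))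

twice≢suc-twice : ∀ a b → twice a ≢ suc (twice b)
twice≢suc-twice (suc a) (suc b) eq = twice≢suc-twice a b (suc-injective (suc-injective eq))

twice-mono-< : ∀ {a b} → a < b → twice a < twice b
twice-mono-< {zero}  {suc b} _         = s≤s z≤n
twice-mono-< {suc a} {suc b} (s≤s a<b) = s≤s (s≤s (twice-mono-< a<b))

swapPairs : ℕ → ℕ
swapPairs 0               = 1
swapPairs 1               = 0
swapPairs (suc (suc c))   = suc (suc (swapPairs c))

swapPairs-involutive : ∀ c → swapPairs (swapPairs c) ≡ c
swapPairs-involutive 0             = refl
swapPairs-involutive 1             = refl
swapPairs-involutive (suc (suc c)) = cong (λ x → suc (suc x)) (swapPairs-involutive c)

swapPairs-twice : ∀ a → swapPairs (twice a) ≡ suc (twice a)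
swapPairs-twice zero    = refl
swapPairs-twice (suc a) = cong (λ x → suc (suc x)) (swapPairs-twice a)

swapPairs-suc-twice : ∀ a → swapPairs (suc (twice a)) ≡ twice a
swapPairs-suc-twice zero    = refl
swapPairs-suc-twice (suc a) = cong (λ x → suc (suc x)) (swapPairs-suc-twice a)

swapPairs≤suc : ∀ c → swapPairs c ≤ suc c
swapPairs≤suc 0             = s≤s z≤n
swapPairs≤suc 1             = z≤n
swapPairs≤suc (suc (suc c)) = s≤s (s≤s (swapPairs≤suc c))

≤suc-swapPairs : ∀ c → c ≤ suc (swapPairs c)
≤suc-swapPairs 0             = z≤n
≤suc-swapPairs 1             = s≤s z≤n
≤suc-swapPairs (suc (suc c)) = s≤s (s≤s (≤suc-swapPairs c))

swapPairs-< : ∀ m {c} → c < twice m → swapPairs c < twice m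
swapPairs-< (suc m) {0}           _                 = s≤s (s≤s z≤n)
swapPairs-< (suc m) {1}           _                 = s≤s z≤n
swapPairs-< (suc m) {suc (suc c)} (s≤s (s≤s c<2m)) = s≤s (s≤s (swapPairs-< m c<2m))

swapPairs-ascent : ∀ c → swapPairs c < swapPairs (suc c) → ∃ λ a → c ≡ suc (twice a)
swapPairs-ascent 1             _                   = 0 , refl
swapPairs-ascent (suc (suc c)) (s≤s (s≤s ascent)) with swapPairs-ascent c ascent
... | a , refl = suc a , refl

swapPairs-descent : ∀ c → swapPairs (suc c) < swapPairs c → ∃ λ a → c ≡ twice a
swapPairs-descent 0             _                    = 0 , refl
swapPairs-descent (suc (suc c)) (s≤s (s≤s descent)) with swapPairs-descent c descent
... | a , refl = suc a , refl

offset-swapPairs : ∀ (size : ℕ → ℕ) (size>0 : ∀ c → 0 < size c) m →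
  Layout.offset (λ c → size (swapPairs c)) (λ c → size>0 (swapPairs c)) (twice m) ≡
  Layout.offset size size>0 (twice m)
offset-swapPairs size size>0 zero    = refl
offset-swapPairs size size>0 (suc m)
  rewrite offset-swapPairs size size>0 m | swapPairs-twice m | swapPairs-suc-twice m =
  xy∙z≈xz∙y _ (size (suc (twice m))) (size (twice m))

isEnd : ℕ → ℕ → Bool
isEnd L a = (a ≡ᵇ 0) ∨ (suc a ≡ᵇ L)

-- The path 0 — 1 — ⋯ — L-1 with a loop at both ends.
pathRel : ℕ → ℕ → ℕ → Bool
pathRel L a c = (c ≡ᵇ suc a) ∨ ((suc c ≡ᵇ a) ∨ ((c ≡ᵇ a) ∧ isEnd L a))

pathRel-self : ∀ L a → pathRel L a a ≡ isEnd L a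
pathRel-self L a
  rewrite ≢⇒≡ᵇ-false (<⇒≢ (n<1+n a)) | ≢⇒≡ᵇ-false (1+n≢n {a}) | ≡ᵇ-refl a = refl

pathRel-suc : ∀ L c → pathRel L c (suc c) ≡ true
pathRel-suc L c = cong (_∨ ((suc (suc c) ≡ᵇ c) ∨ ((suc c ≡ᵇ c) ∧ isEnd L c))) (≡ᵇ-refl c)

pathRel-pred : ∀ L c → pathRel L (suc c) c ≡ true
pathRel-pred L c =
  trans (cong (λ b → (c ≡ᵇ suc (suc c)) ∨ (b ∨ ((c ≡ᵇ suc c) ∧ isEnd L (suc c)))) (≡ᵇ-refl c))
        (∨-zeroʳ (c ≡ᵇ suc (suc c)))

pathRel-≢ : ∀ L {a c} → a ≢ c → pathRel L a c ≡ (c ≡ᵇ suc a) ∨ (suc c ≡ᵇ a)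
pathRel-≢ L {a} {c} a≢c rewrite ≢⇒≡ᵇ-false (≢-sym a≢c) | ∨-identityʳ (suc c ≡ᵇ a) = refl

pathRel-sym : ∀ L a c → pathRel L a c ≡ pathRel L c a
pathRel-sym L a c with a ≟ c
... | yes refl = refl
... | no  a≢c  = begin
  pathRel L a c                     ≡⟨ pathRel-≢ L a≢c ⟩
  (c ≡ᵇ suc a) ∨ (suc c ≡ᵇ a)       ≡⟨ cong₂ _∨_ (≡ᵇ-sym c (suc a)) (≡ᵇ-sym (suc c) a) ⟩
  (suc a ≡ᵇ c) ∨ (a ≡ᵇ suc c)       ≡⟨ ∨-comm (suc a ≡ᵇ c) (a ≡ᵇ suc c) ⟩
  (a ≡ᵇ suc c) ∨ (suc a ≡ᵇ c)       ≡⟨ sym (pathRel-≢ L (≢-sym a≢c)) ⟩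
  pathRel L c a                     ∎
  where open ≡-Reasoning

𝟙-pathRel : ∀ L a c →
  𝟙 (pathRel L a c) ≡ 𝟙 (c ≡ᵇ suc a) + 𝟙 (suc c ≡ᵇ a) + 𝟙 (c ≡ᵇ a) * 𝟙 (isEnd L a)
𝟙-pathRel L a c with c ≟ suc a | suc c ≟ a | c ≟ a
... | yes refl | _        | _
  rewrite ≡ᵇ-refl a | ≢⇒≡ᵇ-false (1+n≢n {a})
        | ≢⇒≡ᵇ-false (>⇒≢ (<-trans (n<1+n a) (n<1+n (suc a)))) = refl
... | no c≢a+1 | yes refl | _
  rewrite ≢⇒≡ᵇ-false c≢a+1 | ≡ᵇ-refl c | ≢⇒≡ᵇ-false (<⇒≢ (n<1+n c)) = refl
... | no c≢a+1 | no c+1≢a | yes refl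
  rewrite ≢⇒≡ᵇ-false c≢a+1 | ≢⇒≡ᵇ-false c+1≢a | ≡ᵇ-refl c = sym (+-identityʳ (𝟙 (isEnd L c)))
... | no c≢a+1 | no c+1≢a | no c≢a
  rewrite ≢⇒≡ᵇ-false c≢a+1 | ≢⇒≡ᵇ-false c+1≢a | ≢⇒≡ᵇ-false c≢a = refl

sum<-pathRel : ∀ L (s : ℕ → ℕ) a → a < L →
  ∑[ c < L ] (s c * 𝟙 (pathRel L a c)) ≡
  ∑[ c < L ] (s c * 𝟙 (c ≡ᵇ suc a)) + ∑[ c < L ] (s c * 𝟙 (suc c ≡ᵇ a)) + s a * 𝟙 (isEnd L a)
sum<-pathRel L s a a<L = begin
  ∑[ c < L ] (s c * 𝟙 (pathRel L a c))
    ≡⟨ sum<-cong L (λ c _ → trans (cong (s c *_) (𝟙-pathRel L a c)) (distrib (s c) _ _ _ _)) ⟩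
  ∑[ c < L ] (s c * 𝟙 (c ≡ᵇ suc a) + s c * 𝟙 (suc c ≡ᵇ a) + s c * e * 𝟙 (c ≡ᵇ a))
    ≡⟨ sum<-distrib L _ _ ⟩
  ∑[ c < L ] (s c * 𝟙 (c ≡ᵇ suc a) + s c * 𝟙 (suc c ≡ᵇ a)) + ∑[ c < L ] (s c * e * 𝟙 (c ≡ᵇ a))
    ≡⟨ cong₂ _+_ (sum<-distrib L _ _) (sum<-indicator L a (λ c → s c * e) a<L) ⟩
  ∑[ c < L ] (s c * 𝟙 (c ≡ᵇ suc a)) + ∑[ c < L ] (s c * 𝟙 (suc c ≡ᵇ a)) + s a * e
    ∎
  where
  open ≡-Reasoning
  e = 𝟙 (isEnd L a)
  distrib : ∀ s i j k e → s * (i + j + k * e) ≡ s * i + s * j + s * e * k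
  distrib = solve-∀

sum<-pathRel-first : ∀ L (s : ℕ → ℕ) → 1 < L → ∑[ c < L ] (s c * 𝟙 (pathRel L 0 c)) ≡ s 1 + s 0
sum<-pathRel-first L s 1<L = begin
  ∑[ c < L ] (s c * 𝟙 (pathRel L 0 c))
    ≡⟨ sum<-pathRel L s 0 (<-trans z<s 1<L) ⟩
  ∑[ c < L ] (s c * 𝟙 (c ≡ᵇ 1)) + ∑[ c < L ] (s c * 0) + s 0 * 1
    ≡⟨ cong₂ _+_ (cong₂ _+_ (sum<-indicator L 1 s 1<L)
                            (trans (sum<-cong L (λ c _ → *-zeroʳ (s c))) (sum<-zero L)))
                 (*-identityʳ (s 0)) ⟩
  s 1 + 0 + s 0
    ≡⟨ cong (_+ s 0) (+-identityʳ (s 1)) ⟩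
  s 1 + s 0
    ∎
  where open ≡-Reasoning

sum<-pathRel-inner : ∀ L (s : ℕ → ℕ) a → suc (suc a) < L →
  ∑[ c < L ] (s c * 𝟙 (pathRel L (suc a) c)) ≡ s (suc (suc a)) + s a
sum<-pathRel-inner L s a a+2<L = begin
  ∑[ c < L ] (s c * 𝟙 (pathRel L (suc a) c))
    ≡⟨ sum<-pathRel L s (suc a) (<-trans (n<1+n (suc a)) a+2<L) ⟩
  ∑[ c < L ] (s c * 𝟙 (c ≡ᵇ suc (suc a))) + ∑[ c < L ] (s c * 𝟙 (c ≡ᵇ a))
    + s (suc a) * 𝟙 (suc (suc a) ≡ᵇ L)
    ≡⟨ cong₂ _+_ (cong₂ _+_ (sum<-indicator L (suc (suc a)) s a+2<L)
                            (sum<-indicator L a s (<-trans (n<1+n a) (<-trans (n<1+n (suc a)) a+2<L))))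
                 (cong (λ b → s (suc a) * 𝟙 b) (≢⇒≡ᵇ-false (<⇒≢ a+2<L))) ⟩
  s (suc (suc a)) + s a + s (suc a) * 0
    ≡⟨ trans (cong (s (suc (suc a)) + s a +_) (*-zeroʳ (s (suc a)))) (+-identityʳ _) ⟩
  s (suc (suc a)) + s a
    ∎
  where open ≡-Reasoning

sum<-pathRel-last : ∀ (s : ℕ → ℕ) a →
  ∑[ c < suc (suc a) ] (s c * 𝟙 (pathRel (suc (suc a)) (suc a) c)) ≡ s a + s (suc a)
sum<-pathRel-last s a = begin
  ∑[ c < L ] (s c * 𝟙 (pathRel L (suc a) c))
    ≡⟨ sum<-pathRel L s (suc a) (n<1+n (suc a)) ⟩
  ∑[ c < L ] (s c * 𝟙 (c ≡ᵇ suc (suc a))) + ∑[ c < L ] (s c * 𝟙 (c ≡ᵇ a))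
    + s (suc a) * 𝟙 (suc (suc a) ≡ᵇ L)
    ≡⟨ cong₂ _+_ (cong₂ _+_ (sum<-indicator-≥ L (suc (suc a)) s ≤-refl)
                            (sum<-indicator L a s (<-trans (n<1+n a) (n<1+n (suc a)))))
                 (cong (λ b → s (suc a) * 𝟙 b) (≡ᵇ-refl L)) ⟩
  s a + s (suc a) * 1
    ≡⟨ cong (s a +_) (*-identityʳ (s (suc a))) ⟩
  s a + s (suc a)
    ∎
  where
  open ≡-Reasoning
  L = suc (suc a)

swapInnerPairs : ℕ → ℕ → ℕ
swapInnerPairs E zero    = zero
swapInnerPairs E (suc c) = if c ≡ᵇ E then suc c else suc (swapPairs c)

moves≤1-monotone : ∀ (f : ℕ → ℕ) → (∀ c → f c ≤ suc c) → (∀ c → c ≤ suc (f c)) →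
                   ∀ {c d} → suc c < d → f c ≤ f d
moves≤1-monotone f f≤suc ≤suc-f {c} {d} c+1<d = ≤-trans (f≤suc c) (≤-pred (≤-trans c+1<d (≤suc-f d)))

module PathRealisation (h : ℕ) where

  E L : ℕ
  E = twice h
  L = suc (suc E)

  Q : ℕ → ℕ
  Q = swapInnerPairs E

  Q-last : Q (suc E) ≡ suc E
  Q-last = cong (λ b → if b then suc E else suc (swapPairs E)) (≡ᵇ-refl E)

  Q-inner : ∀ {c} → c ≢ E → Q (suc c) ≡ suc (swapPairs c)
  Q-inner {c} c≢E = cong (λ b → if b then suc c else suc (swapPairs c)) (≢⇒≡ᵇ-false c≢E)

  suc-twice≢E : ∀ a → suc (twice a) ≢ E
  suc-twice≢E a eq = twice≢suc-twice h a (sym eq)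

  <E⇒swapPairs<E : ∀ {c} → c < E → swapPairs c < E
  <E⇒swapPairs<E = swapPairs-< h

  swapPairs≢E : ∀ {c} → c < E → swapPairs c ≢ E
  swapPairs≢E c<E = <⇒≢ (<E⇒swapPairs<E c<E)

  inner : ∀ {c} → suc c < L → c ≢ E → c < E
  inner (s≤s c<E+1) c≢E = ≤∧≢⇒< (≤-pred c<E+1) c≢E

  Q-involutive : ∀ {c} → c < L → Q (Q c) ≡ c
  Q-involutive {zero}  _     = refl
  Q-involutive {suc c} c+1<L with c ≟ E
  ... | yes refl = trans (cong Q Q-last) Q-last
  ... | no  c≢E  = begin
    Q (Q (suc c))                 ≡⟨ cong Q (Q-inner c≢E) ⟩
    Q (suc (swapPairs c))         ≡⟨ Q-inner (swapPairs≢E (inner c+1<L c≢E)) ⟩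
    suc (swapPairs (swapPairs c)) ≡⟨ cong suc (swapPairs-involutive c) ⟩
    suc c                         ∎
    where open ≡-Reasoning

  Q-< : ∀ {c} → c < L → Q c < L
  Q-< {zero}  0<L   = 0<L
  Q-< {suc c} c+1<L with c ≟ E
  ... | yes refl = subst (_< L) (sym Q-last) c+1<L
  ... | no  c≢E  =
    subst (_< L) (sym (Q-inner c≢E)) (s≤s (<-trans (<E⇒swapPairs<E (inner c+1<L c≢E)) (n<1+n E)))

  Q≤suc : ∀ c → Q c ≤ suc c
  Q≤suc zero    = z≤n
  Q≤suc (suc c) with c ≟ E
  ... | yes refl = subst (_≤ suc (suc E)) (sym Q-last) (n≤1+n _)
  ... | no  c≢E  = subst (_≤ suc (suc c)) (sym (Q-inner c≢E)) (s≤s (swapPairs≤suc c))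

  ≤suc-Q : ∀ c → c ≤ suc (Q c)
  ≤suc-Q zero    = z≤n
  ≤suc-Q (suc c) with c ≟ E
  ... | yes refl = subst (λ q → suc E ≤ suc q) (sym Q-last) (n≤1+n _)
  ... | no  c≢E  = subst (λ q → suc c ≤ suc q) (sym (Q-inner c≢E)) (s≤s (≤suc-swapPairs c))

  Q-2+twice : ∀ a → Q (suc (suc (twice a))) ≡ suc (twice a)
  Q-2+twice a = trans (Q-inner (suc-twice≢E a)) (cong suc (swapPairs-suc-twice a))

  Q-1+twice : ∀ {a} → twice a ≢ E → Q (suc (twice a)) ≡ suc (suc (twice a))
  Q-1+twice {a} 2a≢E = trans (Q-inner 2a≢E) (cong suc (swapPairs-twice a))

  Q-twice≤ : ∀ a → Q (twice a) ≤ twice a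
  Q-twice≤ zero    = z≤n
  Q-twice≤ (suc a) = ≤-trans (≤-reflexive (Q-2+twice a)) (n≤1+n _)

  suc-twice≤Q : ∀ a → suc (twice a) ≤ Q (suc (twice a))
  suc-twice≤Q a with twice a ≟ E
  ... | yes 2a≡E = ≤-reflexive (sym (subst (λ e → Q (suc e) ≡ suc e) (sym 2a≡E) Q-last))
  ... | no  2a≢E = ≤-trans (n≤1+n _) (≤-reflexive (sym (Q-1+twice 2a≢E)))

  offset-Q : ∀ (size : ℕ → ℕ) (size>0 : ∀ c → 0 < size c) →
    Layout.offset (λ c → size (Q c)) (λ c → size>0 (Q c)) L ≡ Layout.offset size size>0 L
  offset-Q size size>0 = cong₂ _+_ (upto-E h ≤-refl) (cong size Q-last)
    where
    module New = Layout (λ c → size (Q c)) (λ c → size>0 (Q c))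
    module Old = Layout size size>0
    upto-E : ∀ m → twice m ≤ E → New.offset (suc (twice m)) ≡ Old.offset (suc (twice m))
    upto-E zero    _      = refl
    upto-E (suc m) 2m+2≤E
      rewrite upto-E m (≤-trans (n≤1+n _) (≤-trans (n≤1+n _) 2m+2≤E))
            | Q-1+twice (<⇒≢ (≤-trans (n≤1+n _) 2m+2≤E)) | Q-2+twice m =
      xy∙z≈xz∙y _ (size (suc (suc (twice m)))) (size (suc (twice m)))

  pathRel-inversions : ∀ {c d} → c < L → d < L → c ≢ d → swapPairs c < swapPairs d →
                       pathRel L c d ≡ true ⇔ Q d < Q c
  pathRel-inversions {c} {d} c<L d<L c≢d Pc<Pd with d ≟ suc c | c ≟ suc d
  ... | yes refl | _ with swapPairs-ascent c Pc<Pd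
  ...   | a , refl = mk⇔ (λ _ → Q-descends) (λ _ → pathRel-suc L c)
    where
    2a≢E : twice a ≢ E
    2a≢E = <⇒≢ (≤-pred (≤-pred d<L))
    Q-descends : Q (suc (suc (twice a))) < Q (suc (twice a))
    Q-descends = subst₂ _<_ (sym (Q-2+twice a)) (sym (Q-1+twice 2a≢E)) (n<1+n _)
  pathRel-inversions {c} {d} c<L d<L c≢d Pc<Pd | no _ | yes refl with swapPairs-descent d Pc<Pd
  ...   | a , refl = mk⇔ (λ _ → <-≤-trans (s≤s (Q-twice≤ a)) (suc-twice≤Q a))
                         (λ _ → pathRel-pred L d)
  pathRel-inversions {c} {d} c<L d<L c≢d Pc<Pd | no d≢c+1 | no c≢d+1 =
    mk⇔ (λ pathRel≡true → ⊥-elim (false≢true (trans (sym not-adjacent) pathRel≡true)))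
        (λ Qd<Qc → ⊥-elim (<⇒≱ Qd<Qc (moves≤1-monotone Q Q≤suc ≤suc-Q c+1<d)))
    where
    false≢true : false ≢ true
    false≢true ()
    not-adjacent : pathRel L c d ≡ false
    not-adjacent =
      trans (pathRel-≢ L c≢d) (cong₂ _∨_ (≢⇒≡ᵇ-false d≢c+1) (≢⇒≡ᵇ-false (≢-sym c≢d+1)))
    c+1<d : suc c < d
    c+1<d with <-cmp c d
    ... | tri< c<d _ _ = ≤∧≢⇒< c<d (≢-sym d≢c+1)
    ... | tri≈ _ c≡d _ = ⊥-elim (c≢d c≡d)
    ... | tri> _ _ d<c = ⊥-elim (<⇒≱ Pc<Pd
      (moves≤1-monotone swapPairs swapPairs≤suc ≤suc-swapPairs (≤∧≢⇒< d<c (≢-sym c≢d+1))))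

blockSize : ℕ → ℕ → ℕ
blockSize r′ 0                         = 2
blockSize r′ 1                         = suc (suc r′)
blockSize r′ 2                         = suc r′
blockSize r′ 3                         = 1
blockSize r′ (suc (suc (suc (suc c)))) = blockSize r′ c

blockSize>0 : ∀ r′ c → 0 < blockSize r′ c
blockSize>0 r′ 0                         = z<s
blockSize>0 r′ 1                         = z<s
blockSize>0 r′ 2                         = z<s
blockSize>0 r′ 3                         = z<s
blockSize>0 r′ (suc (suc (suc (suc c)))) = blockSize>0 r′ c

blockSize-+2 : ∀ r′ c → blockSize r′ c + blockSize r′ (suc (suc c)) ≡ 3 + r′
blockSize-+2 r′ 0                         = refl
blockSize-+2 r′ 1                         = cong (λ x → suc (suc x)) (+-comm r′ 1)
blockSize-+2 r′ 2                         = cong suc (+-comm r′ 2)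
blockSize-+2 r′ 3                         = refl
blockSize-+2 r′ (suc (suc (suc (suc c)))) = blockSize-+2 r′ c

blockSize-4m : ∀ r′ m → blockSize r′ (twice (twice m)) ≡ 2
blockSize-4m r′ zero    = refl
blockSize-4m r′ (suc m) = blockSize-4m r′ m

blockSize-4m+1 : ∀ r′ m → blockSize r′ (suc (twice (twice m))) ≡ suc (suc r′)
blockSize-4m+1 r′ zero    = refl
blockSize-4m+1 r′ (suc m) = blockSize-4m+1 r′ m

module Construction (r′ k : ℕ) where

  open PathRealisation (twice (suc k))

  size : ℕ → ℕ
  size = blockSize r′

  open BlowUp size (blockSize>0 r′) L (pathRel L) (pathRel-sym L) public

  block-degree : ∀ a → a < L → ∑[ c < L ] (size c * 𝟙 (pathRel L a c)) ≡ 3 + r′ + 𝟙 (pathRel L a a)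
  block-degree zero _ =
    trans (sum<-pathRel-first L size (s≤s z<s)) (cong (λ x → suc (suc x)) (+-suc r′ 1))
  block-degree (suc a) a+1<L with a ≟ E
  ... | yes refl = begin
    ∑[ c < L ] (size c * 𝟙 (pathRel L (suc E) c))
      ≡⟨ sum<-pathRel-last size E ⟩
    size E + size (suc E)
      ≡⟨ cong₂ _+_ (blockSize-4m r′ (suc k)) (blockSize-4m+1 r′ (suc k)) ⟩
    3 + suc r′
      ≡⟨ cong (3 +_) (+-comm 1 r′) ⟩
    3 + r′ + 1
      ≡⟨ cong (λ b → 3 + r′ + 𝟙 b) (sym (trans (pathRel-self L (suc E)) (≡ᵇ-refl E))) ⟩
    3 + r′ + 𝟙 (pathRel L (suc E) (suc E))
      ∎
    where open ≡-Reasoning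
  ... | no  a≢E  = begin
    ∑[ c < L ] (size c * 𝟙 (pathRel L (suc a) c))
      ≡⟨ sum<-pathRel-inner L size a a+2<L ⟩
    size (suc (suc a)) + size a
      ≡⟨ +-comm (size (suc (suc a))) (size a) ⟩
    size a + size (suc (suc a))
      ≡⟨ blockSize-+2 r′ a ⟩
    3 + r′
      ≡⟨ sym (+-identityʳ (3 + r′)) ⟩
    3 + r′ + 0
      ≡⟨ cong (λ b → 3 + r′ + 𝟙 b) (sym (trans (pathRel-self L (suc a)) (≢⇒≡ᵇ-false (<⇒≢ a+2<L)))) ⟩
    3 + r′ + 𝟙 (pathRel L (suc a) (suc a))
      ∎
    where
    open ≡-Reasoning
    a+2<L : suc (suc a) < L
    a+2<L = s≤s (s≤s (inner a+1<L a≢E))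

  regular : Regular (3 + r′) blowUp
  regular = blowUp-regular (3 + r′) block-degree

  connected : Connected blowUp
  connected = blowUp-connected z<s refl (λ c _ → pathRel-pred L c)

  isPermutationGraph : IsPermutationGraph blowUp
  isPermutationGraph =
    blowUp-isPermutationGraph swapPairs Q
      (swapPairs-< (suc (twice (suc k)))) (λ {c} _ → swapPairs-involutive c) Q-< Q-involutive
      (offset-swapPairs size (blockSize>0 r′) (suc (twice (suc k)))) (offset-Q size (blockSize>0 r′))
      pathRel-inversions

order-mono-< : ∀ r′ {k l} → k < l → Construction.order r′ k < Construction.order r′ l
order-mono-< r′ k<l = Layout.offset-mono-< (blockSize r′) (blockSize>0 r′)
                         (s≤s (s≤s (twice-mono-< (twice-mono-< (s≤s k<l)))))

order-injective : ∀ r′ {k l} → k ≢ l → Construction.order r′ k ≢ Construction.order r′ l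
order-injective r′ {k} {l} k≢l eq with <-cmp k l
... | tri< k<l _ _ = <-irrefl eq (order-mono-< r′ k<l)
... | tri≈ _ k≡l _ = k≢l k≡l
... | tri> _ _ l<k = <-irrefl (sym eq) (order-mono-< r′ l<k)

theorem1p1 : (r : ℕ) → r ≥ 3 →
    Σ (ℕ → AnyGraph) λ F →
      (∀ k → Connected (proj₂ (F k)) × Regular r (proj₂ (F k))
               × IsPermutationGraph (proj₂ (F k)))
      × (∀ k l → ¬ k ≡ l → ¬ Isomorphic (proj₂ (F k)) (proj₂ (F l)))
theorem1p1 (suc (suc (suc r′))) (s≤s (s≤s (s≤s _))) =
  (λ k → order k , blowUp k) ,
  (λ k → connected k , regular k , isPermutationGraph k) ,
  (λ k l k≢l (bijection , _) → refute (order-injective r′ k≢l) bijection)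
  where open Construction r′
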